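{- Let $K$ be the graph obtained from the complete graph $K_4$ by subdividing one of its edges once; label its vertices $v_1,\dots,v_5$ so that $v_1$ is the subdivision vertex, $E(K)=\{v_1v_2,v_1v_3,v_2v_4,v_2v_5,v_3v_4,v_3v_5,v_4v_5\}$. Let $G$ be any cubic graph containing $K$ as a subgraph, and let $b$ denote the edge of $G$ incident to $v_1$ that is not in $K$ (a bridge of $G$). Then: (a) in any normal edge-coloring of $G$, all edges of $K$ are rich; (b) in any normal edge-coloring of $G$, the seven edges of $K$ receive pairwise different colors; (c) $\chi'_N(G)\geq 7$, i.e., $G$ admits no normal $k$-edge-coloring with $k\leq 6$; (d) in any normal $7$-edge-coloring of $G$, the edges $v_4v_5$ and $b$ receive the same color.
   Context: Graphs may have parallel edges but no loops. A $k$-edge-coloring of a graph is an assignment of colors from $\{1,\dots,k\}$ to its edges such that adjacent edges receive different colors. For an edge-coloring $c$ and a vertex $v$, let $S_c(v)$ be the set of colors of the edges incident to $v$. In a cubic graph, an edge $uv$ is poor with respect to $c$ if $|S_c(u)\cup S_c(v)|=3$ and rich if $|S_c(u)\cup S_c(v)|=5$. An edge-coloring of a cubic graph is normal if every edge is poor or rich. $\chi'_N(G)$ denotes the smallest $k$ such that $G$ admits a normal $k$-edge-coloring. -}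

module Defs where

open import Data.Nat using (ℕ; _≤_)
open import Data.Fin using (Fin; zero; suc; _≟_)
open import Data.Fin.Subset using (Subset; ⁅_⁆; _∪_; ⋃; ∣_∣)
open import Data.List using (List; map; filter; length; allFin)
open import Data.Product using (_×_; _,_)
open import Data.Sum using (_⊎_)
open import Relation.Nullary using (¬_; Dec)
open import Relation.Nullary.Decidable using (_⊎-dec_)
open import Relation.Binary.PropositionalEquality using (_≡_; _≢_)
open import Function.Definitions using (Injective)

-- A finite multigraph: parallel edges allowed, loops forbidden.
-- Vertices are Fin n, edges are Fin m, edge e joins end₁ e and end₂ e.
record Multigraph : Set where
  field
    n      : ℕ
    m      : ℕ
    end₁   : Fin m → Fin n
    end₂   : Fin m → Fin n
    noLoop : ∀ e → end₁ e ≢ end₂ e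

module _ (G : Multigraph) where
  open Multigraph G

  Incident : Fin n → Fin m → Set
  Incident v e = (end₁ e ≡ v) ⊎ (end₂ e ≡ v)

  incident? : (v : Fin n) → (e : Fin m) → Dec (Incident v e)
  incident? v e = (end₁ e ≟ v) ⊎-dec (end₂ e ≟ v)

  edgesAt : Fin n → List (Fin m)
  edgesAt v = filter (incident? v) (allFin m)

  degree : Fin n → ℕ
  degree v = length (edgesAt v)

  Cubic : Set
  Cubic = ∀ v → degree v ≡ 3

  Adjacent : Fin m → Fin m → Set
  Adjacent e f = e ≢ f × (Σ-end e f)
    where
      Σ-end : Fin m → Fin m → Set
      Σ-end e f = (Incident (end₁ e) f) ⊎ (Incident (end₂ e) f)

  -- k-edge-coloring: colors are Fin k (standing for {1,…,k})
  IsEdgeColoring : (k : ℕ) → (Fin m → Fin k) → Set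
  IsEdgeColoring k c = ∀ e f → Adjacent e f → c e ≢ c f

  S : {k : ℕ} → (Fin m → Fin k) → Fin n → Subset k
  S c v = ⋃ (map (λ e → ⁅ c e ⁆) (edgesAt v))

  Poor : {k : ℕ} → (Fin m → Fin k) → Fin m → Set
  Poor c e = ∣ S c (end₁ e) ∪ S c (end₂ e) ∣ ≡ 3

  Rich : {k : ℕ} → (Fin m → Fin k) → Fin m → Set
  Rich c e = ∣ S c (end₁ e) ∪ S c (end₂ e) ∣ ≡ 5

  IsNormal : (k : ℕ) → (Fin m → Fin k) → Set
  IsNormal k c = IsEdgeColoring k c × (∀ e → Poor c e ⊎ Rich c e)

  EndsAre : Fin m → Fin n → Fin n → Set
  EndsAre e x y = (end₁ e ≡ x × end₂ e ≡ y) ⊎ (end₁ e ≡ y × end₂ e ≡ x)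

-- The graph K: K₄ with one edge subdivided.
-- Vertices v₁,…,v₅ are Fin 5 indices 0,…,4 (v₁ = subdivision vertex).
-- Edges (Fin 7): 0:v₁v₂ 1:v₁v₃ 2:v₂v₄ 3:v₂v₅ 4:v₃v₄ 5:v₃v₅ 6:v₄v₅
v₁ v₂ v₃ v₄ v₅ : Fin 5
v₁ = zero
v₂ = suc zero
v₃ = suc (suc zero)
v₄ = suc (suc (suc zero))
v₅ = suc (suc (suc (suc zero)))

e₁₂ e₁₃ e₂₄ e₂₅ e₃₄ e₃₅ e₄₅ : Fin 7
e₁₂ = zero
e₁₃ = suc zero
e₂₄ = suc (suc zero)
e₂₅ = suc (suc (suc zero))
e₃₄ = suc (suc (suc (suc zero)))
e₃₅ = suc (suc (suc (suc (suc zero))))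
e₄₅ = suc (suc (suc (suc (suc (suc zero)))))

K-end₁ K-end₂ : Fin 7 → Fin 5
K-end₁ zero = v₁
K-end₁ (suc zero) = v₁
K-end₁ (suc (suc zero)) = v₂
K-end₁ (suc (suc (suc zero))) = v₂
K-end₁ (suc (suc (suc (suc zero)))) = v₃
K-end₁ (suc (suc (suc (suc (suc zero))))) = v₃
K-end₁ (suc (suc (suc (suc (suc (suc zero)))))) = v₄
K-end₂ zero = v₂
K-end₂ (suc zero) = v₃
K-end₂ (suc (suc zero)) = v₄
K-end₂ (suc (suc (suc zero))) = v₅
K-end₂ (suc (suc (suc (suc zero)))) = v₄
K-end₂ (suc (suc (suc (suc (suc zero))))) = v₅
K-end₂ (suc (suc (suc (suc (suc (suc zero)))))) = v₅

-- A copy of K as a subgraph of G: injective vertex map φ and an edge map ψ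
-- sending each edge of K to an edge of G with the corresponding ends
-- (ψ is then automatically injective since K is simple and φ injective).
record KSubgraph (G : Multigraph) : Set where
  open Multigraph G
  field
    φ     : Fin 5 → Fin n
    φ-inj : Injective _≡_ _≡_ φ
    ψ     : Fin 7 → Fin m
    ψ-ends : ∀ i → EndsAre G (ψ i) (φ (K-end₁ i)) (φ (K-end₂ i))

-- In a properly coloured cubic graph every colour set S(v) has exactly three elements, so an
-- edge uv is poor iff S(u) = S(v) and rich iff S(u) ∩ S(v) consists of the colour of uv alone.
-- If v₄v₅ were poor, the colour sets of v₄ and v₅ would coincide; this forces v₂v₄ and v₃v₄ to
-- share two colours, hence to be poor as well, and then both v₁v₂ and v₁v₃ get the colour of
-- v₄v₅, contradicting properness at v₁. So v₄v₅ is rich, and going around K the richness of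
-- each edge excludes poorness of the next, until all seven edges are rich and all their colours
-- differ. With at most six colours this is impossible, and with seven colours the bridge b,
-- whose colour avoids the six edges at v₁, v₂ and v₃, must repeat the colour of v₄v₅.
module Submission where

open import Defs
open import Data.Nat using (ℕ; zero; suc; _≤_; _+_; z≤n)
open import Data.Nat.Properties
  using (≤-trans; ≤-reflexive; ≤-<-trans; <⇒≱; <-irrefl; +-suc; m≤m+n; +-mono-≤;
         +-cancelˡ-≤; module ≤-Reasoning)
open import Data.Fin using (Fin; zero; suc; _≟_)
open import Data.Fin.Subset using (Subset; inside; outside; _∈_; _∉_; _⊆_; _∪_; _∩_; ⋃; ⁅_⁆; ∣_∣)
open import Data.Fin.Subset.Properties
  using (_∈?_; ∣⊤∣≡n; ∈⊤; ∣⊥∣≡0; ∣⁅x⁆∣≡1; x∈⁅x⁆; x∈p∪q⁺; x∈p∩q⁺; q⊆p∪q; ∪-comm;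
         p⊂q⇒∣p∣<∣q∣; x∈p⇒∣p-x∣<∣p∣; x∈p∧x≢y⇒x∈p-y)
open import Data.Vec using ([]; _∷_)
open import Data.List using (List; []; _∷_; map; length; tabulate; allFin)
open import Data.List.Properties using (length-map)
open import Data.List.Membership.Propositional using () renaming (_∈_ to _∈ₗ_)
open import Data.List.Membership.Propositional.Properties using (∈-filter⁺; ∈-allFin)
open import Data.List.Relation.Unary.Any using (here; there; any?)
open import Data.List.Relation.Unary.All as All using (All; []; _∷_)
open import Data.List.Relation.Unary.All.Properties using (¬Any⇒All¬; All¬⇒¬Any; all-filter)
import Data.List.Relation.Unary.All.Properties as All
open import Data.List.Relation.Unary.AllPairs using (AllPairs; []; _∷_)
open import Data.List.Relation.Unary.Unique.Propositional.Properties using (filter⁺; allFin⁺)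
open import Data.Product using (_×_; _,_; proj₁; proj₂)
open import Data.Sum using (_⊎_; inj₁; inj₂)
open import Function using (id)
open import Relation.Nullary using (¬_; yes; no; contradiction)
open import Relation.Nullary.Decidable using (decidable-stable)
open import Relation.Binary.PropositionalEquality using (_≡_; _≢_; refl; sym; trans; cong; subst; ≢-sym)
open import Function.Definitions using (Injective)

∣p∪q∣+∣p∩q∣≡∣p∣+∣q∣ : ∀ {n} (p q : Subset n) → ∣ p ∪ q ∣ + ∣ p ∩ q ∣ ≡ ∣ p ∣ + ∣ q ∣
∣p∪q∣+∣p∩q∣≡∣p∣+∣q∣ []            []            = refl
∣p∪q∣+∣p∩q∣≡∣p∣+∣q∣ (inside  ∷ p) (inside  ∷ q) =
  cong suc (trans (+-suc ∣ p ∪ q ∣ ∣ p ∩ q ∣)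
                  (trans (cong suc (∣p∪q∣+∣p∩q∣≡∣p∣+∣q∣ p q)) (sym (+-suc ∣ p ∣ ∣ q ∣))))
∣p∪q∣+∣p∩q∣≡∣p∣+∣q∣ (inside  ∷ p) (outside ∷ q) = cong suc (∣p∪q∣+∣p∩q∣≡∣p∣+∣q∣ p q)
∣p∪q∣+∣p∩q∣≡∣p∣+∣q∣ (outside ∷ p) (inside  ∷ q) =
  trans (cong suc (∣p∪q∣+∣p∩q∣≡∣p∣+∣q∣ p q)) (sym (+-suc ∣ p ∣ ∣ q ∣))
∣p∪q∣+∣p∩q∣≡∣p∣+∣q∣ (outside ∷ p) (outside ∷ q) = ∣p∪q∣+∣p∩q∣≡∣p∣+∣q∣ p q

module _ {n : ℕ} where

  ∣p∪q∣≤∣p∣+∣q∣ : ∀ (p q : Subset n) → ∣ p ∪ q ∣ ≤ ∣ p ∣ + ∣ q ∣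
  ∣p∪q∣≤∣p∣+∣q∣ p q = ≤-trans (m≤m+n ∣ p ∪ q ∣ ∣ p ∩ q ∣) (≤-reflexive (∣p∪q∣+∣p∩q∣≡∣p∣+∣q∣ p q))

  ∣p∪q∣≤∣q∣⇒p⊆q : ∀ {p q : Subset n} → ∣ p ∪ q ∣ ≤ ∣ q ∣ → p ⊆ q
  ∣p∪q∣≤∣q∣⇒p⊆q {p} {q} ∣p∪q∣≤∣q∣ {x} x∈p with x ∈? q
  ... | yes x∈q = x∈q
  ... | no  x∉q = contradiction ∣p∪q∣≤∣q∣
                    (<⇒≱ (p⊂q⇒∣p∣<∣q∣ (q⊆p∪q p q , x , x∈p∪q⁺ (inj₁ x∈p) , x∉q)))

  ∣p∪q∣≤∣p∣⇒q⊆p : ∀ {p q : Subset n} → ∣ p ∪ q ∣ ≤ ∣ p ∣ → q ⊆ p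
  ∣p∪q∣≤∣p∣⇒q⊆p {p} {q} ∣p∪q∣≤∣p∣ = ∣p∪q∣≤∣q∣⇒p⊆q (subst (_≤ ∣ p ∣) (cong ∣_∣ (∪-comm p q)) ∣p∪q∣≤∣p∣)

  distinct-members⇒length≤∣p∣ : ∀ {p : Subset n} {xs : List (Fin n)} →
    AllPairs _≢_ xs → All (_∈ p) xs → length xs ≤ ∣ p ∣
  distinct-members⇒length≤∣p∣ []               []          = z≤n
  distinct-members⇒length≤∣p∣ (x∉xs ∷ distinct) (x∈p ∷ xs⊆p) =
    ≤-<-trans (distinct-members⇒length≤∣p∣ distinct xs⊆p-x) (x∈p⇒∣p-x∣<∣p∣ x∈p)
    where
    xs⊆p-x = All.zipWith (λ (y∈p , x≢y) → x∈p∧x≢y⇒x∈p-y y∈p (≢-sym x≢y)) (xs⊆p , x∉xs)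

  distinct⇒length≤n : ∀ {xs : List (Fin n)} → AllPairs _≢_ xs → length xs ≤ n
  distinct⇒length≤n {xs} distinct =
    subst (length xs ≤_) (∣⊤∣≡n n) (distinct-members⇒length≤∣p∣ distinct (All.universal (λ _ → ∈⊤) xs))

  ∣p∣≤length⇒∈-exhaustive : ∀ {p : Subset n} {xs : List (Fin n)} {x : Fin n} →
    AllPairs _≢_ xs → All (_∈ p) xs → ∣ p ∣ ≤ length xs → x ∈ p → x ∈ₗ xs
  ∣p∣≤length⇒∈-exhaustive {xs = xs} {x} distinct xs⊆p ∣p∣≤ x∈p with any? (x ≟_) xs
  ... | yes x∈xs = x∈xs
  ... | no  x∉xs = contradiction ∣p∣≤
                    (<⇒≱ (distinct-members⇒length≤∣p∣ (¬Any⇒All¬ xs x∉xs ∷ distinct) (x∈p ∷ xs⊆p)))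

  ∣p∣≤1⇒x≡y : ∀ {p : Subset n} {x y : Fin n} → ∣ p ∣ ≤ 1 → x ∈ p → y ∈ p → x ≡ y
  ∣p∣≤1⇒x≡y {x = x} {y} ∣p∣≤1 x∈p y∈p with x ≟ y
  ... | yes x≡y = x≡y
  ... | no  x≢y = contradiction ∣p∣≤1
                    (<⇒≱ (distinct-members⇒length≤∣p∣ ((x≢y ∷ []) ∷ [] ∷ []) (x∈p ∷ y∈p ∷ [])))

  module _ {a} {A : Set a} (f : A → Fin n) where

    ∈⋃-singletons⁺ : ∀ {xs : List A} {x : A} → x ∈ₗ xs → f x ∈ ⋃ (map (λ y → ⁅ f y ⁆) xs)
    ∈⋃-singletons⁺ (here refl) = x∈p∪q⁺ (inj₁ (x∈⁅x⁆ (f _)))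
    ∈⋃-singletons⁺ (there x∈xs) = x∈p∪q⁺ (inj₂ (∈⋃-singletons⁺ x∈xs))

    ∣⋃-singletons∣≤length : ∀ (xs : List A) → ∣ ⋃ (map (λ y → ⁅ f y ⁆) xs) ∣ ≤ length xs
    ∣⋃-singletons∣≤length []       = ≤-reflexive (∣⊥∣≡0 n)
    ∣⋃-singletons∣≤length (x ∷ xs) =
      ≤-trans (∣p∪q∣≤∣p∣+∣q∣ ⁅ f x ⁆ _) (+-mono-≤ (≤-reflexive (∣⁅x⁆∣≡1 (f x))) (∣⋃-singletons∣≤length xs))

tabulate-distinct⇒injective : ∀ {a} {A : Set a} {n} {f : Fin n → A} →
  AllPairs _≢_ (tabulate f) → Injective _≡_ _≡_ f
tabulate-distinct⇒injective (f₀∉ ∷ distinct) {zero}  {zero}  _  = refl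
tabulate-distinct⇒injective (f₀∉ ∷ distinct) {zero}  {suc j} eq = contradiction eq (All.tabulate⁻ f₀∉ j)
tabulate-distinct⇒injective (f₀∉ ∷ distinct) {suc i} {zero}  eq = contradiction (sym eq) (All.tabulate⁻ f₀∉ i)
tabulate-distinct⇒injective (f₀∉ ∷ distinct) {suc i} {suc j} eq =
  cong suc (tabulate-distinct⇒injective distinct eq)

module _ (G : Multigraph) where
  open Multigraph G

  ends-incident₁ : ∀ {e x y} → EndsAre G e x y → Incident G x e
  ends-incident₁ (inj₁ (e≡x , _)) = inj₁ e≡x
  ends-incident₁ (inj₂ (_ , e≡x)) = inj₂ e≡x

  ends-incident₂ : ∀ {e x y} → EndsAre G e x y → Incident G y e
  ends-incident₂ (inj₁ (_ , e≡y)) = inj₂ e≡y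
  ends-incident₂ (inj₂ (e≡y , _)) = inj₁ e≡y

  incident⇒end : ∀ {e x y z} → EndsAre G e x y → Incident G z e → z ≡ x ⊎ z ≡ y
  incident⇒end (inj₁ (refl , refl)) (inj₁ refl) = inj₁ refl
  incident⇒end (inj₁ (refl , refl)) (inj₂ refl) = inj₂ refl
  incident⇒end (inj₂ (refl , refl)) (inj₁ refl) = inj₂ refl
  incident⇒end (inj₂ (refl , refl)) (inj₂ refl) = inj₁ refl

  module _ {k : ℕ} (c : Fin m → Fin k) where

    ∈S⁺ : ∀ {v e} → Incident G v e → c e ∈ S G c v
    ∈S⁺ {v} {e} v∈e = ∈⋃-singletons⁺ c (∈-filter⁺ (incident? G v) (∈-allFin e) v∈e)

    ∣S∣≤degree : ∀ v → ∣ S G c v ∣ ≤ degree G v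
    ∣S∣≤degree v = ∣⋃-singletons∣≤length c (edgesAt G v)

    proper-at : IsEdgeColoring G k c → ∀ {v e f} → Incident G v e → Incident G v f → e ≢ f → c e ≢ c f
    proper-at proper (inj₁ refl) v∈f e≢f = proper _ _ (e≢f , inj₁ v∈f)
    proper-at proper (inj₂ refl) v∈f e≢f = proper _ _ (e≢f , inj₂ v∈f)

    degree≤∣S∣ : IsEdgeColoring G k c → ∀ v → degree G v ≤ ∣ S G c v ∣
    degree≤∣S∣ proper v =
      subst (_≤ ∣ S G c v ∣) (length-map c (edgesAt G v))
        (distinct-members⇒length≤∣p∣
          (colours-distinct (all-filter (incident? G v) (allFin m)) (filter⁺ (incident? G v) (allFin⁺ m)))
          (All.map⁺ (All.tabulate (∈⋃-singletons⁺ c))))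
      where
      colours-distinct : ∀ {es} → All (Incident G v) es → AllPairs _≢_ es → AllPairs _≢_ (map c es)
      colours-distinct []             []                = []
      colours-distinct (v∈e ∷ v∈es) (e∉es ∷ distinct) =
        All.map⁺ (All.zipWith (λ (v∈f , e≢f) → proper-at proper v∈e v∈f e≢f) (v∈es , e∉es))
        ∷ colours-distinct v∈es distinct

module _ (G : Multigraph) (cubic : Cubic G) {k : ℕ} {c : Fin (Multigraph.m G) → Fin k}
         (proper : IsEdgeColoring G k c) where
  open Multigraph G

  ∣S∣≤3 : ∀ v → ∣ S G c v ∣ ≤ 3
  ∣S∣≤3 v = subst (∣ S G c v ∣ ≤_) (cubic v) (∣S∣≤degree G c v)

  3≤∣S∣ : ∀ v → 3 ≤ ∣ S G c v ∣
  3≤∣S∣ v = subst (_≤ ∣ S G c v ∣) (cubic v) (degree≤∣S∣ G c proper v)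

  poor⇒S⊆S : ∀ {e x y} → EndsAre G e x y → Poor G c e → S G c x ⊆ S G c y
  poor⇒S⊆S (inj₁ (refl , refl)) poor = ∣p∪q∣≤∣q∣⇒p⊆q (≤-trans (≤-reflexive poor) (3≤∣S∣ _))
  poor⇒S⊆S (inj₂ (refl , refl)) poor = ∣p∪q∣≤∣p∣⇒q⊆p (≤-trans (≤-reflexive poor) (3≤∣S∣ _))

  rich⇒common-colour : ∀ {e d} → Rich G c e →
    d ∈ S G c (end₁ e) → d ∈ S G c (end₂ e) → d ≡ c e
  rich⇒common-colour {e} rich d∈S₁ d∈S₂ =
    ∣p∣≤1⇒x≡y ∣S₁∩S₂∣≤1 (x∈p∩q⁺ (d∈S₁ , d∈S₂)) (x∈p∩q⁺ (∈S⁺ G c (inj₁ refl) , ∈S⁺ G c (inj₂ refl)))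
    where
    S₁ S₂ : Subset k
    S₁ = S G c (end₁ e)
    S₂ = S G c (end₂ e)
    open ≤-Reasoning
    ∣S₁∩S₂∣≤1 : ∣ S₁ ∩ S₂ ∣ ≤ 1
    ∣S₁∩S₂∣≤1 = +-cancelˡ-≤ 5 ∣ S₁ ∩ S₂ ∣ 1 (begin
      5 + ∣ S₁ ∩ S₂ ∣          ≡⟨ cong (_+ ∣ S₁ ∩ S₂ ∣) rich ⟨
      ∣ S₁ ∪ S₂ ∣ + ∣ S₁ ∩ S₂ ∣ ≡⟨ ∣p∪q∣+∣p∩q∣≡∣p∣+∣q∣ S₁ S₂ ⟩
      ∣ S₁ ∣ + ∣ S₂ ∣          ≤⟨ +-mono-≤ (∣S∣≤3 (end₁ e)) (∣S∣≤3 (end₂ e)) ⟩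
      6                        ∎)

  rich⇒S∩S : ∀ {e x y d} → EndsAre G e x y → Rich G c e → d ∈ S G c x → d ∈ S G c y → d ≡ c e
  rich⇒S∩S (inj₁ (refl , refl)) rich d∈Sx d∈Sy = rich⇒common-colour rich d∈Sx d∈Sy
  rich⇒S∩S (inj₂ (refl , refl)) rich d∈Sx d∈Sy = rich⇒common-colour rich d∈Sy d∈Sx

  ≢colours⇒∉S : ∀ {u e f g d} → Incident G u e → Incident G u f → Incident G u g →
    c e ≢ c f → c e ≢ c g → c f ≢ c g → d ≢ c e → d ≢ c f → d ≢ c g → d ∉ S G c u
  ≢colours⇒∉S {u} u∈e u∈f u∈g ce≢cf ce≢cg cf≢cg d≢ce d≢cf d≢cg d∈S =
    All¬⇒¬Any (d≢ce ∷ d≢cf ∷ d≢cg ∷ [])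
      (∣p∣≤length⇒∈-exhaustive ((ce≢cf ∷ ce≢cg ∷ []) ∷ (cf≢cg ∷ []) ∷ [] ∷ [])
        (∈S⁺ G c u∈e ∷ ∈S⁺ G c u∈f ∷ ∈S⁺ G c u∈g ∷ []) (∣S∣≤3 u) d∈S)

module _ {G : Multigraph} (H : KSubgraph G) where
  open Multigraph G
  open KSubgraph H

  ψ-at₁ : ∀ i → Incident G (φ (K-end₁ i)) (ψ i)
  ψ-at₁ i = ends-incident₁ G (ψ-ends i)

  ψ-at₂ : ∀ i → Incident G (φ (K-end₂ i)) (ψ i)
  ψ-at₂ i = ends-incident₂ G (ψ-ends i)

  ψ-separated : ∀ {i j u} → Incident G (φ u) (ψ i) → u ≢ K-end₁ j → u ≢ K-end₂ j → ψ i ≢ ψ j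
  ψ-separated {j = j} φu∈ψi u≢end₁ u≢end₂ ψi≡ψj
    with incident⇒end G (ψ-ends j) (subst (Incident G _) ψi≡ψj φu∈ψi)
  ... | inj₁ φu≡ = u≢end₁ (φ-inj φu≡)
  ... | inj₂ φu≡ = u≢end₂ (φ-inj φu≡)

module NormalColouringOfK (G : Multigraph) (cubic : Cubic G) (H : KSubgraph G)
                          {k : ℕ} (c : Fin (Multigraph.m G) → Fin k) (normal : IsNormal G k c) where
  open Multigraph G
  open KSubgraph H

  proper : IsEdgeColoring G k c
  proper = proj₁ normal

  colour : Fin 7 → Fin k
  colour i = c (ψ i)

  c₁₂ c₁₃ c₂₄ c₂₅ c₃₄ c₃₅ c₄₅ : Fin k
  c₁₂ = colour e₁₂
  c₁₃ = colour e₁₃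
  c₂₄ = colour e₂₄
  c₂₅ = colour e₂₅
  c₃₄ = colour e₃₄
  c₃₅ = colour e₃₅
  c₄₅ = colour e₄₅

  rich-unless-poor : ∀ {e} → ¬ Poor G c e → Rich G c e
  rich-unless-poor {e} ¬poor with proj₂ normal e
  ... | inj₁ poor = contradiction poor ¬poor
  ... | inj₂ rich = rich

  poor-unless-rich : ∀ {e} → ¬ Rich G c e → Poor G c e
  poor-unless-rich {e} ¬rich with proj₂ normal e
  ... | inj₁ poor = poor
  ... | inj₂ rich = contradiction rich ¬rich

  poor-transfers : ∀ {i f} → Poor G c (ψ i) → Incident G (φ (K-end₁ i)) f → c f ∈ S G c (φ (K-end₂ i))
  poor-transfers {i} poor u∈f = poor⇒S⊆S G cubic proper (ψ-ends i) poor (∈S⁺ G c u∈f)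

  rich-separates : ∀ {i f g} → Rich G c (ψ i) →
    Incident G (φ (K-end₁ i)) f → Incident G (φ (K-end₂ i)) g → c f ≢ colour i → c f ≢ c g
  rich-separates {i} rich u∈f v∈g cf≢ci cf≡cg =
    cf≢ci (rich⇒S∩S G cubic proper (ψ-ends i) rich (∈S⁺ G c u∈f)
            (subst (_∈ S G c (φ (K-end₂ i))) (sym cf≡cg) (∈S⁺ G c v∈g)))

  c₁₂≢c₁₃ : c₁₂ ≢ c₁₃
  c₁₂≢c₁₃ = proper-at G c proper (ψ-at₁ H e₁₂) (ψ-at₁ H e₁₃) (ψ-separated H (ψ-at₂ H e₁₂) (λ ()) (λ ()))
  c₁₂≢c₂₄ : c₁₂ ≢ c₂₄
  c₁₂≢c₂₄ = proper-at G c proper (ψ-at₂ H e₁₂) (ψ-at₁ H e₂₄) (ψ-separated H (ψ-at₁ H e₁₂) (λ ()) (λ ()))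
  c₁₂≢c₂₅ : c₁₂ ≢ c₂₅
  c₁₂≢c₂₅ = proper-at G c proper (ψ-at₂ H e₁₂) (ψ-at₁ H e₂₅) (ψ-separated H (ψ-at₁ H e₁₂) (λ ()) (λ ()))
  c₂₄≢c₂₅ : c₂₄ ≢ c₂₅
  c₂₄≢c₂₅ = proper-at G c proper (ψ-at₁ H e₂₄) (ψ-at₁ H e₂₅) (ψ-separated H (ψ-at₂ H e₂₄) (λ ()) (λ ()))
  c₁₃≢c₃₄ : c₁₃ ≢ c₃₄
  c₁₃≢c₃₄ = proper-at G c proper (ψ-at₂ H e₁₃) (ψ-at₁ H e₃₄) (ψ-separated H (ψ-at₁ H e₁₃) (λ ()) (λ ()))
  c₁₃≢c₃₅ : c₁₃ ≢ c₃₅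
  c₁₃≢c₃₅ = proper-at G c proper (ψ-at₂ H e₁₃) (ψ-at₁ H e₃₅) (ψ-separated H (ψ-at₁ H e₁₃) (λ ()) (λ ()))
  c₃₄≢c₃₅ : c₃₄ ≢ c₃₅
  c₃₄≢c₃₅ = proper-at G c proper (ψ-at₁ H e₃₄) (ψ-at₁ H e₃₅) (ψ-separated H (ψ-at₂ H e₃₄) (λ ()) (λ ()))
  c₂₄≢c₃₄ : c₂₄ ≢ c₃₄
  c₂₄≢c₃₄ = proper-at G c proper (ψ-at₂ H e₂₄) (ψ-at₂ H e₃₄) (ψ-separated H (ψ-at₁ H e₂₄) (λ ()) (λ ()))
  c₂₄≢c₄₅ : c₂₄ ≢ c₄₅
  c₂₄≢c₄₅ = proper-at G c proper (ψ-at₂ H e₂₄) (ψ-at₁ H e₄₅) (ψ-separated H (ψ-at₁ H e₂₄) (λ ()) (λ ()))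
  c₃₄≢c₄₅ : c₃₄ ≢ c₄₅
  c₃₄≢c₄₅ = proper-at G c proper (ψ-at₂ H e₃₄) (ψ-at₁ H e₄₅) (ψ-separated H (ψ-at₁ H e₃₄) (λ ()) (λ ()))
  c₂₅≢c₃₅ : c₂₅ ≢ c₃₅
  c₂₅≢c₃₅ = proper-at G c proper (ψ-at₂ H e₂₅) (ψ-at₂ H e₃₅) (ψ-separated H (ψ-at₁ H e₂₅) (λ ()) (λ ()))
  c₂₅≢c₄₅ : c₂₅ ≢ c₄₅
  c₂₅≢c₄₅ = proper-at G c proper (ψ-at₂ H e₂₅) (ψ-at₂ H e₄₅) (ψ-separated H (ψ-at₁ H e₂₅) (λ ()) (λ ()))
  c₃₅≢c₄₅ : c₃₅ ≢ c₄₅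
  c₃₅≢c₄₅ = proper-at G c proper (ψ-at₂ H e₃₅) (ψ-at₂ H e₄₅) (ψ-separated H (ψ-at₁ H e₃₅) (λ ()) (λ ()))

  ∉S₂ : ∀ {d} → d ≢ c₁₂ → d ≢ c₂₄ → d ≢ c₂₅ → d ∉ S G c (φ v₂)
  ∉S₂ = ≢colours⇒∉S G cubic proper (ψ-at₂ H e₁₂) (ψ-at₁ H e₂₄) (ψ-at₁ H e₂₅) c₁₂≢c₂₄ c₁₂≢c₂₅ c₂₄≢c₂₅

  ∉S₃ : ∀ {d} → d ≢ c₁₃ → d ≢ c₃₄ → d ≢ c₃₅ → d ∉ S G c (φ v₃)
  ∉S₃ = ≢colours⇒∉S G cubic proper (ψ-at₂ H e₁₃) (ψ-at₁ H e₃₄) (ψ-at₁ H e₃₅) c₁₃≢c₃₄ c₁₃≢c₃₅ c₃₄≢c₃₅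

  ∉S₄ : ∀ {d} → d ≢ c₂₄ → d ≢ c₃₄ → d ≢ c₄₅ → d ∉ S G c (φ v₄)
  ∉S₄ = ≢colours⇒∉S G cubic proper (ψ-at₂ H e₂₄) (ψ-at₂ H e₃₄) (ψ-at₁ H e₄₅) c₂₄≢c₃₄ c₂₄≢c₄₅ c₃₄≢c₄₅

  ∉S₅ : ∀ {d} → d ≢ c₂₅ → d ≢ c₃₅ → d ≢ c₄₅ → d ∉ S G c (φ v₅)
  ∉S₅ = ≢colours⇒∉S G cubic proper (ψ-at₂ H e₂₅) (ψ-at₂ H e₃₅) (ψ-at₂ H e₄₅) c₂₅≢c₃₅ c₂₅≢c₄₅ c₃₅≢c₄₅

  ¬poor₄₅ : ¬ Poor G c (ψ e₄₅)
  ¬poor₄₅ poor₄₅ = c₁₂≢c₁₃ (trans c₁₂≡c₄₅ (sym c₁₃≡c₄₅))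
    where
    c₂₄≡c₃₅ : c₂₄ ≡ c₃₅
    c₂₄≡c₃₅ = decidable-stable (c₂₄ ≟ c₃₅) λ c₂₄≢c₃₅ →
      ∉S₅ c₂₄≢c₂₅ c₂₄≢c₃₅ c₂₄≢c₄₅ (poor-transfers poor₄₅ (ψ-at₂ H e₂₄))
    c₃₄≡c₂₅ : c₃₄ ≡ c₂₅
    c₃₄≡c₂₅ = decidable-stable (c₃₄ ≟ c₂₅) λ c₃₄≢c₂₅ →
      ∉S₅ c₃₄≢c₂₅ c₃₄≢c₃₅ c₃₄≢c₄₅ (poor-transfers poor₄₅ (ψ-at₂ H e₃₄))
    poor₂₄ : Poor G c (ψ e₂₄)
    poor₂₄ = poor-unless-rich λ rich₂₄ →
      rich-separates rich₂₄ (ψ-at₁ H e₂₅) (ψ-at₂ H e₃₄) (≢-sym c₂₄≢c₂₅) (sym c₃₄≡c₂₅)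
    poor₃₄ : Poor G c (ψ e₃₄)
    poor₃₄ = poor-unless-rich λ rich₃₄ →
      rich-separates rich₃₄ (ψ-at₁ H e₃₅) (ψ-at₂ H e₂₄) (≢-sym c₃₄≢c₃₅) (sym c₂₄≡c₃₅)
    c₁₂≡c₄₅ : c₁₂ ≡ c₄₅
    c₁₂≡c₄₅ = decidable-stable (c₁₂ ≟ c₄₅) λ c₁₂≢c₄₅ →
      ∉S₄ c₁₂≢c₂₄ (λ c₁₂≡c₃₄ → c₁₂≢c₂₅ (trans c₁₂≡c₃₄ c₃₄≡c₂₅)) c₁₂≢c₄₅ (poor-transfers poor₂₄ (ψ-at₂ H e₁₂))
    c₁₃≡c₄₅ : c₁₃ ≡ c₄₅
    c₁₃≡c₄₅ = decidable-stable (c₁₃ ≟ c₄₅) λ c₁₃≢c₄₅ →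
      ∉S₄ (λ c₁₃≡c₂₄ → c₁₃≢c₃₅ (trans c₁₃≡c₂₄ c₂₄≡c₃₅)) c₁₃≢c₃₄ c₁₃≢c₄₅ (poor-transfers poor₃₄ (ψ-at₂ H e₁₃))

  rich₄₅ : Rich G c (ψ e₄₅)
  rich₄₅ = rich-unless-poor ¬poor₄₅

  c₂₄≢c₃₅ : c₂₄ ≢ c₃₅
  c₂₄≢c₃₅ = rich-separates rich₄₅ (ψ-at₂ H e₂₄) (ψ-at₂ H e₃₅) c₂₄≢c₄₅
  c₂₅≢c₃₄ : c₂₅ ≢ c₃₄
  c₂₅≢c₃₄ = ≢-sym (rich-separates rich₄₅ (ψ-at₂ H e₃₄) (ψ-at₂ H e₂₅) c₃₄≢c₄₅)

  rich₂₄ : Rich G c (ψ e₂₄)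
  rich₂₄ = rich-unless-poor λ poor →
    ∉S₄ (≢-sym c₂₄≢c₂₅) c₂₅≢c₃₄ c₂₅≢c₄₅ (poor-transfers poor (ψ-at₁ H e₂₅))

  rich₂₅ : Rich G c (ψ e₂₅)
  rich₂₅ = rich-unless-poor λ poor →
    ∉S₅ c₂₄≢c₂₅ c₂₄≢c₃₅ c₂₄≢c₄₅ (poor-transfers poor (ψ-at₁ H e₂₄))

  rich₃₄ : Rich G c (ψ e₃₄)
  rich₃₄ = rich-unless-poor λ poor →
    ∉S₄ (≢-sym c₂₄≢c₃₅) (≢-sym c₃₄≢c₃₅) c₃₅≢c₄₅ (poor-transfers poor (ψ-at₁ H e₃₅))

  rich₃₅ : Rich G c (ψ e₃₅)
  rich₃₅ = rich-unless-poor λ poor →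
    ∉S₅ (≢-sym c₂₅≢c₃₄) c₃₄≢c₃₅ c₃₄≢c₄₅ (poor-transfers poor (ψ-at₁ H e₃₄))

  c₁₂≢c₃₄ : c₁₂ ≢ c₃₄
  c₁₂≢c₃₄ = rich-separates rich₂₄ (ψ-at₂ H e₁₂) (ψ-at₂ H e₃₄) c₁₂≢c₂₄
  c₁₂≢c₄₅ : c₁₂ ≢ c₄₅
  c₁₂≢c₄₅ = rich-separates rich₂₄ (ψ-at₂ H e₁₂) (ψ-at₁ H e₄₅) c₁₂≢c₂₄
  c₁₂≢c₃₅ : c₁₂ ≢ c₃₅
  c₁₂≢c₃₅ = rich-separates rich₂₅ (ψ-at₂ H e₁₂) (ψ-at₂ H e₃₅) c₁₂≢c₂₅
  c₁₃≢c₂₄ : c₁₃ ≢ c₂₄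
  c₁₃≢c₂₄ = rich-separates rich₃₄ (ψ-at₂ H e₁₃) (ψ-at₂ H e₂₄) c₁₃≢c₃₄
  c₁₃≢c₄₅ : c₁₃ ≢ c₄₅
  c₁₃≢c₄₅ = rich-separates rich₃₄ (ψ-at₂ H e₁₃) (ψ-at₁ H e₄₅) c₁₃≢c₃₄
  c₁₃≢c₂₅ : c₁₃ ≢ c₂₅
  c₁₃≢c₂₅ = rich-separates rich₃₅ (ψ-at₂ H e₁₃) (ψ-at₂ H e₂₅) c₁₃≢c₃₅

  rich₁₂ : Rich G c (ψ e₁₂)
  rich₁₂ = rich-unless-poor λ poor →
    ∉S₂ (≢-sym c₁₂≢c₁₃) c₁₃≢c₂₄ c₁₃≢c₂₅ (poor-transfers poor (ψ-at₁ H e₁₃))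

  rich₁₃ : Rich G c (ψ e₁₃)
  rich₁₃ = rich-unless-poor λ poor →
    ∉S₃ c₁₂≢c₁₃ c₁₂≢c₃₄ c₁₂≢c₃₅ (poor-transfers poor (ψ-at₁ H e₁₂))

  K-rich : ∀ i → Rich G c (ψ i)
  K-rich = All.tabulate⁻ {P = λ i → Rich G c (ψ i)} {f = id}
    (rich₁₂ ∷ rich₁₃ ∷ rich₂₄ ∷ rich₂₅ ∷ rich₃₄ ∷ rich₃₅ ∷ rich₄₅ ∷ [])

  K-colours-distinct : AllPairs _≢_ (tabulate colour)
  K-colours-distinct =
      (c₁₂≢c₁₃ ∷ c₁₂≢c₂₄ ∷ c₁₂≢c₂₅ ∷ c₁₂≢c₃₄ ∷ c₁₂≢c₃₅ ∷ c₁₂≢c₄₅ ∷ [])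
    ∷ (c₁₃≢c₂₄ ∷ c₁₃≢c₂₅ ∷ c₁₃≢c₃₄ ∷ c₁₃≢c₃₅ ∷ c₁₃≢c₄₅ ∷ [])
    ∷ (c₂₄≢c₂₅ ∷ c₂₄≢c₃₄ ∷ c₂₄≢c₃₅ ∷ c₂₄≢c₄₅ ∷ [])
    ∷ (c₂₅≢c₃₄ ∷ c₂₅≢c₃₅ ∷ c₂₅≢c₄₅ ∷ [])
    ∷ (c₃₄≢c₃₅ ∷ c₃₄≢c₄₅ ∷ [])
    ∷ (c₃₅≢c₄₅ ∷ [])
    ∷ []
    ∷ []

  7≤k : 7 ≤ k
  7≤k = distinct⇒length≤n K-colours-distinct

  bridge-colour-fresh : ∀ {b} → Incident G (φ v₁) b → b ≢ ψ e₁₂ → b ≢ ψ e₁₃ →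
    c b ≢ c₄₅ → AllPairs _≢_ (c b ∷ tabulate colour)
  bridge-colour-fresh v₁∈b b≢ψ₁₂ b≢ψ₁₃ cb≢c₄₅ =
    (cb≢c₁₂ ∷ cb≢c₁₃ ∷ cb≢c₂₄ ∷ cb≢c₂₅ ∷ cb≢c₃₄ ∷ cb≢c₃₅ ∷ cb≢c₄₅ ∷ []) ∷ K-colours-distinct
    where
    cb≢c₁₂ = proper-at G c proper v₁∈b (ψ-at₁ H e₁₂) b≢ψ₁₂
    cb≢c₁₃ = proper-at G c proper v₁∈b (ψ-at₁ H e₁₃) b≢ψ₁₃
    cb≢c₂₄ = rich-separates rich₁₂ v₁∈b (ψ-at₁ H e₂₄) cb≢c₁₂
    cb≢c₂₅ = rich-separates rich₁₂ v₁∈b (ψ-at₁ H e₂₅) cb≢c₁₂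
    cb≢c₃₄ = rich-separates rich₁₃ v₁∈b (ψ-at₁ H e₃₄) cb≢c₁₃
    cb≢c₃₅ = rich-separates rich₁₃ v₁∈b (ψ-at₁ H e₃₅) cb≢c₁₃

theorem3 : (G : Multigraph) → Cubic G → (H : KSubgraph G) →
    ((k : ℕ) → (c : Fin (Multigraph.m G) → Fin k) → IsNormal G k c →
      ∀ i → Rich G c (KSubgraph.ψ H i))
  × ((k : ℕ) → (c : Fin (Multigraph.m G) → Fin k) → IsNormal G k c →
      Injective _≡_ _≡_ (λ i → c (KSubgraph.ψ H i)))
  × ((k : ℕ) → k ≤ 6 → (c : Fin (Multigraph.m G) → Fin k) → ¬ IsNormal G k c)
  × ((c : Fin (Multigraph.m G) → Fin 7) → IsNormal G 7 c →
      (b : Fin (Multigraph.m G)) → Incident G (KSubgraph.φ H v₁) b →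
      b ≢ KSubgraph.ψ H e₁₂ → b ≢ KSubgraph.ψ H e₁₃ →
      c (KSubgraph.ψ H e₄₅) ≡ c b)
theorem3 G cubic H =
    (λ k c normal → K-rich c normal)
  , (λ k c normal → tabulate-distinct⇒injective (K-colours-distinct c normal))
  , (λ k k≤6 c normal → <⇒≱ (7≤k c normal) k≤6)
  , λ c normal b v₁∈b b≢ψ₁₂ b≢ψ₁₃ → decidable-stable (c₄₅ c normal ≟ c b) λ c₄₅≢cb →
      <-irrefl refl (distinct⇒length≤n (bridge-colour-fresh c normal v₁∈b b≢ψ₁₂ b≢ψ₁₃ (≢-sym c₄₅≢cb)))
  where open NormalColouringOfK G cubic H
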